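{- Let $p$ be a prime and let $A\subseteq(\mathbb{Z}/p\mathbb{Z})^2$ be a $g$-difference set of size $|A|=m$. Then for every positive integer $s$, there is a $g(s-1)$-difference set $C\subseteq\mathbb{Z}/p^2s\mathbb{Z}$ of size $|C|=ms$.
   Context: For a subset $A$ of an abelian group $G$, let $r_A(x)=|\{(a_1,a_2)\in A\times A: x=a_1-a_2\}|$. $A$ is a $g$-difference set (in $G$) if $r_A(x)\ge g$ for all $x\in G$. -}

module Defs where

open import Data.Nat using (ℕ; zero; suc; _+_; _∸_)
open import Data.Nat.DivMod using (_mod_)
open import Data.Fin using (Fin; toℕ)
open import Data.Bool using (Bool; true; false; _∧_)
open import Data.Product using (_×_; _,_)
open import Data.List using (List; length; filterᵇ; allFin; cartesianProduct)
open import Relation.Nullary.Decidable using (⌊_⌋)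
open import Relation.Binary.PropositionalEquality using (_≡_)

-- Generic notions for a finite abelian group G given by the list of its
-- elements (each exactly once), its subtraction, and decidable equality.

size : {G : Set} → List G → (G → Bool) → ℕ
size elems A = length (filterᵇ A elems)

rep : {G : Set} → List G → (G → G → G) → (G → G → Bool) →
      (G → Bool) → G → ℕ
rep elems sub eqb A x =
  length (filterᵇ (λ { (a₁ , a₂) → A a₁ ∧ A a₂ ∧ eqb x (sub a₁ a₂) })
                  (cartesianProduct elems elems))

IsDiffSet : {G : Set} → List G → (G → G → G) → (G → G → Bool) →
            ℕ → (G → Bool) → Set
IsDiffSet {G} elems sub eqb g A = (x : G) → g Data.Nat.≤ rep elems sub eqb A x

ZMod : ℕ → Set
ZMod n = Fin n

subZ : {n : ℕ} → ZMod n → ZMod n → ZMod n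
subZ {suc k} a b = (toℕ a + (suc k ∸ toℕ b)) mod (suc k)

eqZ : {n : ℕ} → ZMod n → ZMod n → Bool
eqZ a b = ⌊ a Data.Fin.≟ b ⌋

elemsZ : (n : ℕ) → List (ZMod n)
elemsZ n = allFin n

IsDiffSetZ : (n : ℕ) → ℕ → (ZMod n → Bool) → Set
IsDiffSetZ n = IsDiffSet (elemsZ n) subZ eqZ

sizeZ : (n : ℕ) → (ZMod n → Bool) → ℕ
sizeZ n = size (elemsZ n)

ZMod² : ℕ → Set
ZMod² n = ZMod n × ZMod n

subZ² : {n : ℕ} → ZMod² n → ZMod² n → ZMod² n
subZ² (a , b) (c , d) = subZ a c , subZ b d

eqZ² : {n : ℕ} → ZMod² n → ZMod² n → Bool
eqZ² (a , b) (c , d) = eqZ a c ∧ eqZ b d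

elemsZ² : (n : ℕ) → List (ZMod² n)
elemsZ² n = cartesianProduct (allFin n) (allFin n)

IsDiffSetZ² : (n : ℕ) → ℕ → (ZMod² n → Bool) → Set
IsDiffSetZ² n = IsDiffSet (elemsZ² n) subZ² eqZ²

sizeZ² : (n : ℕ) → (ZMod² n → Bool) → ℕ
sizeZ² n = size (elemsZ² n)

module Submission where

-- Write the residues of ℤ/N, N = p·p·s, in mixed radix as c = p·(s·b + j) + a
-- with a, b < p and j < s, and put  C = { p·(s·b + j) + a : (a , b) ∈ A, j < s },
-- so that |C| = s·|A|.  Fix x = p·(s·v + w) + u.  If (a₁ , b₁) - (a₂ , b₂)
-- equals (u , v) in (ℤ/p)², with carry δ ≤ 1 in the first digit, then every
-- j₂ with j₂ + w + δ < s gives a representation x = c₁ - c₂ (with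
-- j₁ = j₂ + w + δ): at least s - 1 - w of them.  If the difference is
-- (u , v + 1) instead, the middle digit wraps around and at least w choices
-- of j₁ work.  The two kinds of pairs are disjoint, hence
--   r_C(x) ≥ (s - 1 - w)·r_A(u , v) + w·r_A(u , v + 1) ≥ g·(s - 1).

open import Defs
open import Data.Bool using (Bool; true; false; T; _∧_)
open import Data.Bool.Properties using (T-∧)
open import Data.Empty using (⊥; ⊥-elim)
open import Data.Fin as Fin using (Fin; toℕ; fromℕ<; cast; combine; remQuot; _↑ˡ_; _↑ʳ_)
open import Data.Fin.Properties
  using (toℕ-fromℕ<; toℕ-injective; toℕ<n; toℕ-cast; cast-is-id; cast-involutive;
         toℕ-combine; combine-remQuot; remQuot-combine)
open import Data.List using (List; []; _∷_; length; filterᵇ; map; tabulate; allFin; cartesianProduct; _++_)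
open import Data.List.Properties using (map-++; map-∘)
open import Data.Nat using (ℕ; zero; suc; _+_; _*_; _∸_; _⊓_; _≤_; _<_; _≥_; _<ᵇ_; _≤?_; z≤n; s≤s⁻¹)
open import Data.Nat.DivMod using (_mod_; _/_; _%_; m≡m%n+[m/n]*n; [m+kn]%n≡m%n; [m+n]%n≡m%n; m<n⇒m%n≡m)
open import Data.Nat.ListAction using () renaming (sum to listSum)
open import Data.Nat.ListAction.Properties using () renaming (sum-++ to listSum-++)
open import Data.Nat.Primality using (Prime; ¬prime[0]; ¬prime[1])
open import Data.Nat.Properties
open import Data.Nat.Tactic.RingSolver using (solve)
open import Data.Product using (Σ; ∃-syntax; _×_; _,_; proj₁; proj₂)
open import Function using (_∘_; id)
open import Function.Bundles using (Equivalence)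
open import Relation.Binary.PropositionalEquality
open import Relation.Nullary using (¬_; yes; no)
open import Relation.Nullary.Decidable using (toWitness; fromWitness)

open import Algebra.Properties.CommutativeSemigroup +-commutativeSemigroup
  using (xy∙z≈xz∙y; xy∙z≈y∙xz; xy∙z≈zx∙y)
open import Algebra.Properties.Semiring.Sum +-*-semiring
  using (sum; sum-syntax; sum-cong-≗; sum-replicate-zero; ∑-distrib-+; ∑-comm; *-distribˡ-sum)

χ : Bool → ℕ
χ true  = 1
χ false = 0

χ-true : ∀ {b} → T b → χ b ≡ 1
χ-true {true} _ = refl

χ-≤ : ∀ {b y} → (T b → 1 ≤ y) → χ b ≤ y
χ-≤ {false} _ = z≤n
χ-≤ {true}  h = h _

T-∧³ : ∀ {x y z} → T x → T y → T z → T (x ∧ y ∧ z)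
T-∧³ {true} {true} _ _ tz = tz

exclusive-weights : ∀ {b c Y} X W → (T b → T c → ⊥) →
  (T b → X ≤ Y) → (T c → W ≤ Y) → X * χ b + W * χ c ≤ Y
exclusive-weights {false} {false} X W _ _ _ =
  ≤-trans (≤-reflexive (cong₂ _+_ (*-zeroʳ X) (*-zeroʳ W))) z≤n
exclusive-weights {true} {false} X W _ hb _ =
  ≤-trans (≤-reflexive (trans (cong₂ _+_ (*-identityʳ X) (*-zeroʳ W)) (+-identityʳ X))) (hb _)
exclusive-weights {false} {true} X W _ _ hc =
  ≤-trans (≤-reflexive (cong₂ _+_ (*-zeroʳ X) (*-identityʳ W))) (hc _)
exclusive-weights {true} {true} X W excl _ _ = ⊥-elim (excl _ _)

∑-mono : ∀ {n} {f g : Fin n → ℕ} → (∀ i → f i ≤ g i) → sum f ≤ sum g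
∑-mono {zero}  _ = z≤n
∑-mono {suc n} h = +-mono-≤ (h Fin.zero) (∑-mono (h ∘ Fin.suc))

∑-term : ∀ {n} (f : Fin n → ℕ) i → f i ≤ sum f
∑-term f Fin.zero    = m≤m+n _ _
∑-term f (Fin.suc i) = ≤-trans (∑-term (f ∘ Fin.suc) i) (m≤n+m _ _)

∑-const : ∀ n c → ∑[ i < n ] c ≡ n * c
∑-const zero    c = refl
∑-const (suc n) c = cong (c +_) (∑-const n c)

∑-linear : ∀ {n} X W (f g : Fin n → ℕ) →
  ∑[ i < n ] (X * f i + W * g i) ≡ X * sum f + W * sum g
∑-linear X W f g =
  trans (∑-distrib-+ (λ i → X * f i) (λ i → W * g i))
        (sym (cong₂ _+_ (*-distribˡ-sum X f) (*-distribˡ-sum W g)))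

∑-χ-< : ∀ n k → ∑[ i < n ] χ (toℕ i <ᵇ k) ≡ k ⊓ n
∑-χ-< zero    k       = sym (⊓-zeroʳ k)
∑-χ-< (suc n) zero    = sum-replicate-zero n
∑-χ-< (suc n) (suc k) = cong suc (∑-χ-< n k)

∑-↑ : ∀ m {n} (f : Fin (m + n) → ℕ) →
  sum f ≡ ∑[ i < m ] f (i ↑ˡ n) + ∑[ j < n ] f (m ↑ʳ j)
∑-↑ zero    f = refl
∑-↑ (suc m) f = trans (cong (f Fin.zero +_) (∑-↑ m (f ∘ Fin.suc))) (sym (+-assoc (f Fin.zero) _ _))

∑-combine : ∀ m n (f : Fin (m * n) → ℕ) → sum f ≡ ∑[ i < m ] ∑[ j < n ] f (combine i j)
∑-combine zero    n f = refl
∑-combine (suc m) n f =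
  trans (∑-↑ n f) (cong (∑[ j < n ] f (j ↑ˡ (m * n)) +_) (∑-combine m n (f ∘ (n ↑ʳ_))))

∑-cast : ∀ {m n} (eq : m ≡ n) (f : Fin n → ℕ) → sum f ≡ ∑[ i < m ] f (cast eq i)
∑-cast refl f = sum-cong-≗ (λ i → cong f (sym (cast-is-id refl i)))

∑² : ∀ n → (Fin n → Fin n → ℕ) → ℕ
∑² n f = ∑[ a < n ] ∑[ b < n ] f a b

∑²-cong : ∀ {n} {f g : Fin n → Fin n → ℕ} → (∀ a b → f a b ≡ g a b) → ∑² n f ≡ ∑² n g
∑²-cong h = sum-cong-≗ (λ a → sum-cong-≗ (h a))

∑²-mono : ∀ {n} {f g : Fin n → Fin n → ℕ} → (∀ a b → f a b ≤ g a b) → ∑² n f ≤ ∑² n g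
∑²-mono h = ∑-mono (λ a → ∑-mono (h a))

∑²-linear : ∀ {n} X W (f g : Fin n → Fin n → ℕ) →
  ∑² n (λ a b → X * f a b + W * g a b) ≡ X * ∑² n f + W * ∑² n g
∑²-linear {n} X W f g = trans (sum-cong-≗ (λ a → ∑-linear X W (f a) (g a)))
                              (∑-linear X W (λ a → ∑[ b < n ] f a b) (λ a → ∑[ b < n ] g a b))

∑²∑²-linear : ∀ {n} X W (f g : Fin n → Fin n → Fin n → Fin n → ℕ) →
  ∑² n (λ a₁ b₁ → ∑² n (λ a₂ b₂ → X * f a₁ b₁ a₂ b₂ + W * g a₁ b₁ a₂ b₂)) ≡
  X * ∑² n (λ a₁ b₁ → ∑² n (f a₁ b₁)) + W * ∑² n (λ a₁ b₁ → ∑² n (g a₁ b₁))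
∑²∑²-linear {n} X W f g = trans (∑²-cong (λ a₁ b₁ → ∑²-linear X W (f a₁ b₁) (g a₁ b₁)))
  (∑²-linear X W (λ a₁ b₁ → ∑² n (f a₁ b₁)) (λ a₁ b₁ → ∑² n (g a₁ b₁)))

∑²-scale : ∀ {n} X (f : Fin n → Fin n → ℕ) → X * ∑² n f ≡ ∑² n (λ a b → X * f a b)
∑²-scale {n} X f = trans (*-distribˡ-sum X (λ a → ∑[ b < n ] f a b)) (sum-cong-≗ (λ a → *-distribˡ-sum X (f a)))

∑-comm₃ : ∀ {l m n} (f : Fin l → Fin m → Fin n → ℕ) →
  ∑[ i < l ] ∑[ j < m ] ∑[ k < n ] f i j k ≡ ∑[ j < m ] ∑[ k < n ] ∑[ i < l ] f i j k
∑-comm₃ f = trans (∑-comm (λ i j → ∑[ k < _ ] f i j k)) (sum-cong-≗ (λ j → ∑-comm (λ i k → f i j k)))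

diagonal-count : ∀ n d (R : Fin n → Fin n → Bool) →
  (∀ i j → toℕ j ≡ toℕ i + d → T (R i j)) →
  n ∸ d ≤ ∑[ i < n ] ∑[ j < n ] χ (R i j)
diagonal-count n d R onDiagonal = begin
  n ∸ d                           ≡⟨ sym (m≤n⇒m⊓n≡m (m∸n≤m n d)) ⟩
  (n ∸ d) ⊓ n                     ≡⟨ sym (∑-χ-< n (n ∸ d)) ⟩
  ∑[ i < n ] χ (toℕ i <ᵇ n ∸ d)   ≤⟨ ∑-mono (λ i → χ-≤ (row i ∘ <ᵇ⇒< _ _)) ⟩
  ∑[ i < n ] ∑[ j < n ] χ (R i j) ∎
  where
  open ≤-Reasoning
  shifted : ∀ {i} → i < n ∸ d → i + d < n
  shifted {i} i<n∸d = subst (i + d <_) (m∸n+n≡m {n} {d} d≤n) (+-monoˡ-< d i<n∸d)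
    where
    d≤n : d ≤ n
    d≤n = <⇒≤ (m∸n≢0⇒n<m {n} {d} (λ n∸d≡0 → n≮0 (subst (i <_) n∸d≡0 i<n∸d)))
  row : ∀ i → toℕ i < n ∸ d → 1 ≤ ∑[ j < n ] χ (R i j)
  row i lt = ≤-trans (≤-reflexive (sym (χ-true (onDiagonal i j (toℕ-fromℕ< _)))))
                     (∑-term (λ j → χ (R i j)) j)
    where j = fromℕ< (shifted lt)

count-as-sum : ∀ {X : Set} (P : X → Bool) xs → length (filterᵇ P xs) ≡ listSum (map (χ ∘ P) xs)
count-as-sum P [] = refl
count-as-sum P (x ∷ xs) with P x
... | true  = cong suc (count-as-sum P xs)
... | false = count-as-sum P xs

listSum-product : ∀ {X Y : Set} (F : X × Y → ℕ) xs (ys : List Y) →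
  listSum (map F (cartesianProduct xs ys)) ≡ listSum (map (λ x → listSum (map (λ y → F (x , y)) ys)) xs)
listSum-product F [] ys = refl
listSum-product F (x ∷ xs) ys = begin
  listSum (map F (map (x ,_) ys ++ cartesianProduct xs ys))
    ≡⟨ cong listSum (map-++ F (map (x ,_) ys) _) ⟩
  listSum (map F (map (x ,_) ys) ++ map F (cartesianProduct xs ys))
    ≡⟨ listSum-++ (map F (map (x ,_) ys)) _ ⟩
  listSum (map F (map (x ,_) ys)) + listSum (map F (cartesianProduct xs ys))
    ≡⟨ cong₂ _+_ (cong listSum (sym (map-∘ ys))) (listSum-product F xs ys) ⟩
  listSum (map (λ y → F (x , y)) ys) + listSum (map (λ x → listSum (map (λ y → F (x , y)) ys)) xs) ∎
  where open ≡-Reasoning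

listSum-tabulate : ∀ {X : Set} n (e : Fin n → X) (F : X → ℕ) → listSum (map F (tabulate e)) ≡ sum (F ∘ e)
listSum-tabulate zero    e F = refl
listSum-tabulate (suc n) e F = cong (F (e Fin.zero) +_) (listSum-tabulate n (e ∘ Fin.suc) F)

listSum-allFin : ∀ n (F : Fin n → ℕ) → listSum (map F (allFin n)) ≡ sum F
listSum-allFin n F = listSum-tabulate n id F

listSum-grid : ∀ n (F : ZMod² n → ℕ) → listSum (map F (elemsZ² n)) ≡ ∑² n (λ a b → F (a , b))
listSum-grid n F = begin
  listSum (map F (elemsZ² n))                                    ≡⟨ listSum-product F (allFin n) (allFin n) ⟩
  listSum (map (λ a → listSum (map (λ b → F (a , b)) (allFin n))) (allFin n))
    ≡⟨ listSum-allFin n _ ⟩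
  ∑[ a < n ] listSum (map (λ b → F (a , b)) (allFin n))
    ≡⟨ sum-cong-≗ (λ a → listSum-allFin n (λ b → F (a , b))) ⟩
  ∑² n (λ a b → F (a , b))                                       ∎
  where open ≡-Reasoning

rep-as-listSum : ∀ {G : Set} (elems : List G) sub eqb (A : G → Bool) x →
  rep elems sub eqb A x ≡
  listSum (map (λ a₁ → listSum (map (λ a₂ → χ (A a₁ ∧ A a₂ ∧ eqb x (sub a₁ a₂))) elems)) elems)
rep-as-listSum elems sub eqb A x =
  trans (count-as-sum _ (cartesianProduct elems elems)) (listSum-product _ elems elems)

sizeZ-as-sum : ∀ n (C : ZMod n → Bool) → sizeZ n C ≡ sum (χ ∘ C)
sizeZ-as-sum n C = trans (count-as-sum C (allFin n)) (listSum-allFin n (χ ∘ C))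

sizeZ²-as-sum : ∀ n (A : ZMod² n → Bool) → sizeZ² n A ≡ ∑² n (λ a b → χ (A (a , b)))
sizeZ²-as-sum n A = trans (count-as-sum A (elemsZ² n)) (listSum-grid n (χ ∘ A))

repZ-as-sum : ∀ n (C : ZMod n → Bool) x →
  rep (elemsZ n) subZ eqZ C x ≡ ∑[ c₁ < n ] ∑[ c₂ < n ] χ (C c₁ ∧ C c₂ ∧ eqZ x (subZ c₁ c₂))
repZ-as-sum n C x = trans (rep-as-listSum (elemsZ n) subZ eqZ C x)
  (trans (listSum-allFin n (λ c₁ → listSum (map (λ c₂ → χ (C c₁ ∧ C c₂ ∧ eqZ x (subZ c₁ c₂))) (allFin n))))
         (sum-cong-≗ (λ c₁ → listSum-allFin n (λ c₂ → χ (C c₁ ∧ C c₂ ∧ eqZ x (subZ c₁ c₂))))))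

differenceIn : ∀ {n} → (ZMod² n → Bool) → ZMod² n → Fin n → Fin n → Fin n → Fin n → ℕ
differenceIn A y a₁ b₁ a₂ b₂ = χ (A (a₁ , b₁) ∧ A (a₂ , b₂) ∧ eqZ² y (subZ² (a₁ , b₁) (a₂ , b₂)))

repZ²-as-sum : ∀ n (A : ZMod² n → Bool) y →
  rep (elemsZ² n) subZ² eqZ² A y ≡ ∑² n (λ a₁ b₁ → ∑² n (differenceIn A y a₁ b₁))
repZ²-as-sum n A y = trans (rep-as-listSum (elemsZ² n) subZ² eqZ² A y)
  (trans (listSum-grid n (λ P₁ → listSum (map (λ P₂ → χ (A P₁ ∧ A P₂ ∧ eqZ² y (subZ² P₁ P₂))) (elemsZ² n))))
         (sum-cong-≗ (λ a₁ → sum-cong-≗ (λ b₁ →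
           listSum-grid n (λ P₂ → χ (A (a₁ , b₁) ∧ A P₂ ∧ eqZ² y (subZ² (a₁ , b₁) P₂)))))))

subZ-unique : ∀ {n} (a b r : Fin (suc n)) e → toℕ a + e * suc n ≡ toℕ b + toℕ r → subZ a b ≡ r
subZ-unique {n} a b r e hyp = toℕ-injective (begin
  toℕ (subZ a b)                     ≡⟨ toℕ-fromℕ< _ ⟩
  (toℕ a + (M ∸ toℕ b)) % M          ≡⟨ sym ([m+kn]%n≡m%n (toℕ a + (M ∸ toℕ b)) e M) ⟩
  (toℕ a + (M ∸ toℕ b) + e * M) % M  ≡⟨ cong (_% M) wrap ⟩
  (toℕ r + M) % M                    ≡⟨ [m+n]%n≡m%n (toℕ r) M ⟩
  toℕ r % M                          ≡⟨ m<n⇒m%n≡m (toℕ<n r) ⟩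
  toℕ r                              ∎)
  where
  open ≡-Reasoning
  M = suc n
  wrap : toℕ a + (M ∸ toℕ b) + e * M ≡ toℕ r + M
  wrap = begin
    toℕ a + (M ∸ toℕ b) + e * M  ≡⟨ xy∙z≈xz∙y (toℕ a) (M ∸ toℕ b) (e * M) ⟩
    toℕ a + e * M + (M ∸ toℕ b)  ≡⟨ cong (_+ (M ∸ toℕ b)) hyp ⟩
    toℕ b + toℕ r + (M ∸ toℕ b)  ≡⟨ xy∙z≈y∙xz (toℕ b) (toℕ r) (M ∸ toℕ b) ⟩
    toℕ r + (toℕ b + (M ∸ toℕ b)) ≡⟨ cong (toℕ r +_) (m+[n∸m]≡n (<⇒≤ (toℕ<n b))) ⟩
    toℕ r + M                    ∎

subZ-representation : ∀ {n} (a b : Fin (suc n)) e r → r < suc n →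
  toℕ a + e * suc n ≡ toℕ b + r → toℕ a + e * suc n ≡ toℕ b + toℕ (subZ a b)
subZ-representation a b e r r<n hyp = trans hyp (cong (toℕ b +_) (sym toℕ-a-b))
  where
  hyp′ = trans hyp (cong (toℕ b +_) (sym (toℕ-fromℕ< r<n)))
  toℕ-a-b : toℕ (subZ a b) ≡ r
  toℕ-a-b = trans (cong toℕ (subZ-unique a b (fromℕ< r<n) e hyp′)) (toℕ-fromℕ< r<n)

subZ-carry : ∀ {n} (a b : Fin (suc n)) →
  ∃[ δ ] (δ ≤ 1 × toℕ a + δ * suc n ≡ toℕ b + toℕ (subZ a b))
subZ-carry {n} a b with toℕ b ≤? toℕ a
... | yes b≤a = 0 , z≤n ,
  subZ-representation a b 0 (toℕ a ∸ toℕ b) a-b<M (trans (+-identityʳ (toℕ a)) (sym (m+[n∸m]≡n b≤a)))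
  where
  a-b<M : toℕ a ∸ toℕ b < suc n
  a-b<M = ≤-<-trans (m∸n≤m (toℕ a) (toℕ b)) (toℕ<n a)
... | no b≰a = 1 , ≤-refl ,
  subZ-representation a b 1 (a+M ∸ toℕ b) (m<n+o⇒m∸n<o a+M (toℕ b) a+M<b+M) (sym (m+[n∸m]≡n b≤a+M))
  where
  a+M : ℕ
  a+M = toℕ a + 1 * suc n
  a+M<b+M : a+M < toℕ b + suc n
  a+M<b+M = +-mono-<-≤ (≰⇒> b≰a) (≤-reflexive (*-identityˡ (suc n)))
  b≤a+M : toℕ b ≤ a+M
  b≤a+M = ≤-trans (<⇒≤ (toℕ<n b)) (≤-trans (≤-reflexive (sym (*-identityˡ (suc n)))) (m≤n+m (1 * suc n) (toℕ a)))

unpack : ∀ {n α β} {u v d e : Fin n} →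
  T (α ∧ β ∧ eqZ u d ∧ eqZ v e) → T α × T β × u ≡ d × v ≡ e
unpack {α = true} {β = true} {u} {v} {d} {e} h =
  _ , _ , toWitness (proj₁ both) , toWitness (proj₂ both)
  where
  both : T (eqZ u d) × T (eqZ v e)
  both = Equivalence.to (T-∧ {eqZ u d} {eqZ v e}) h

-- Subtracting two mixed-radix numerals p·(s·b + j) + a digit by digit, with
-- carries δ into the middle digit, t into the high digit and κ out of the top.
digit-difference : ∀ p s a₁ a₂ u j₁ j₂ w b₁ b₂ v δ t κ →
  a₁ + δ * p ≡ a₂ + u → t * s + j₁ ≡ j₂ + (w + δ) → b₁ + κ * p ≡ t + (b₂ + v) →
  p * (s * b₁ + j₁) + a₁ + κ * (p * p * s) ≡ p * (s * b₂ + j₂) + a₂ + (p * (s * v + w) + u)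
digit-difference p s a₁ a₂ u j₁ j₂ w b₁ b₂ v δ t κ carry-a carry-j carry-b = +-cancelˡ-≡ (p * s * t) _ _ (begin
  p * s * t + (p * (s * b₁ + j₁) + a₁ + κ * (p * p * s))
    ≡⟨ solve (p ∷ s ∷ t ∷ a₁ ∷ j₁ ∷ b₁ ∷ κ ∷ []) ⟩
  a₁ + p * (t * s + j₁) + p * s * (b₁ + κ * p)
    ≡⟨ cong₂ (λ m h → a₁ + p * m + p * s * h) carry-j carry-b ⟩
  a₁ + p * (j₂ + (w + δ)) + p * s * (t + (b₂ + v))
    ≡⟨ solve (p ∷ s ∷ t ∷ a₁ ∷ j₂ ∷ w ∷ δ ∷ b₂ ∷ v ∷ []) ⟩
  (a₁ + δ * p) + (p * j₂ + p * w + p * s * (b₂ + v) + p * s * t)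
    ≡⟨ cong (_+ (p * j₂ + p * w + p * s * (b₂ + v) + p * s * t)) carry-a ⟩
  (a₂ + u) + (p * j₂ + p * w + p * s * (b₂ + v) + p * s * t)
    ≡⟨ solve (p ∷ s ∷ t ∷ a₂ ∷ u ∷ j₂ ∷ w ∷ b₂ ∷ v ∷ []) ⟩
  p * s * t + (p * (s * b₂ + j₂) + a₂ + (p * (s * v + w) + u)) ∎)
  where open ≡-Reasoning

module MixedRadix (p s : ℕ) where

  N : ℕ
  N = p * p * s

  reorder : p * s * p ≡ N
  reorder = trans (*-assoc p s p) (trans (cong (p *_) (*-comm s p)) (sym (*-assoc p p s)))

  opaque
    enc : Fin p → Fin p → Fin s → Fin N
    enc a b j = cast reorder (combine (combine b j) a)

    toℕ-enc : ∀ a b j → toℕ (enc a b j) ≡ p * (s * toℕ b + toℕ j) + toℕ a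
    toℕ-enc a b j = trans (toℕ-cast reorder _)
      (trans (toℕ-combine (combine b j) a) (cong (λ m → p * m + toℕ a) (toℕ-combine b j)))

    digits : Fin N → Fin (p * s) × Fin p
    digits c = remQuot {p * s} p (cast (sym reorder) c)

    low high : Fin N → Fin p
    low c  = proj₂ (digits c)
    high c = proj₁ (remQuot {p} s (proj₁ (digits c)))

    mid : Fin N → Fin s
    mid c = proj₂ (remQuot {p} s (proj₁ (digits c)))

    enc-digits : ∀ c → enc (low c) (high c) (mid c) ≡ c
    enc-digits c = begin
      cast reorder (combine (combine (high c) (mid c)) (low c))
        ≡⟨ cong (λ m → cast reorder (combine m (low c))) (combine-remQuot {p} s (proj₁ (digits c))) ⟩
      cast reorder (combine (proj₁ (digits c)) (low c))
        ≡⟨ cong (cast reorder) (combine-remQuot {p * s} p (cast (sym reorder) c)) ⟩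
      cast reorder (cast (sym reorder) c)
        ≡⟨ cast-involutive reorder (sym reorder) c ⟩
      c ∎
      where open ≡-Reasoning

    digits-enc : ∀ a b j → digits (enc a b j) ≡ (combine b j , a)
    digits-enc a b j = trans (cong (remQuot {p * s} p) (cast-involutive (sym reorder) reorder _))
                             (remQuot-combine (combine b j) a)

    low-enc : ∀ a b j → low (enc a b j) ≡ a
    low-enc a b j = cong proj₂ (digits-enc a b j)

    high-enc : ∀ a b j → high (enc a b j) ≡ b
    high-enc a b j = trans (cong (λ d → proj₁ (remQuot {p} s (proj₁ d))) (digits-enc a b j))
                           (cong proj₁ (remQuot-combine b j))

    ∑-enc : (f : Fin N → ℕ) → sum f ≡ ∑² p (λ a b → ∑[ j < s ] f (enc a b j))
    ∑-enc f = begin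
      sum f                                                    ≡⟨ ∑-cast reorder f ⟩
      ∑[ i < p * s * p ] f (cast reorder i)                    ≡⟨ ∑-combine (p * s) p _ ⟩
      ∑[ h < p * s ] ∑[ a < p ] f (cast reorder (combine h a)) ≡⟨ ∑-combine p s _ ⟩
      ∑[ b < p ] ∑[ j < s ] ∑[ a < p ] f (enc a b j)           ≡⟨ sym (∑-comm₃ (λ a b j → f (enc a b j))) ⟩
      ∑² p (λ a b → ∑[ j < s ] f (enc a b j))                  ∎
      where open ≡-Reasoning

  ∑-enc₂ : (F : Fin N → Fin N → ℕ) →
    ∑[ c₁ < N ] ∑[ c₂ < N ] F c₁ c₂ ≡
    ∑² p (λ a₁ b₁ → ∑² p (λ a₂ b₂ → ∑[ j₁ < s ] ∑[ j₂ < s ] F (enc a₁ b₁ j₁) (enc a₂ b₂ j₂)))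
  ∑-enc₂ F = begin
    ∑[ c₁ < N ] ∑[ c₂ < N ] F c₁ c₂
      ≡⟨ ∑-enc (λ c₁ → ∑[ c₂ < N ] F c₁ c₂) ⟩
    ∑² p (λ a₁ b₁ → ∑[ j₁ < s ] ∑[ c₂ < N ] F (enc a₁ b₁ j₁) c₂)
      ≡⟨ ∑²-cong (λ a₁ b₁ → sum-cong-≗ (λ j₁ → ∑-enc (F (enc a₁ b₁ j₁)))) ⟩
    ∑² p (λ a₁ b₁ → ∑[ j₁ < s ] ∑² p (λ a₂ b₂ → ∑[ j₂ < s ] F (enc a₁ b₁ j₁) (enc a₂ b₂ j₂)))
      ≡⟨ ∑²-cong (λ a₁ b₁ → ∑-comm₃ (λ j₁ a₂ b₂ → ∑[ j₂ < s ] F (enc a₁ b₁ j₁) (enc a₂ b₂ j₂))) ⟩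
    ∑² p (λ a₁ b₁ → ∑² p (λ a₂ b₂ → ∑[ j₁ < s ] ∑[ j₂ < s ] F (enc a₁ b₁ j₁) (enc a₂ b₂ j₂))) ∎
    where open ≡-Reasoning

module Construction (k s′ : ℕ) (A : ZMod² (2 + k) → Bool) where

  p s : ℕ
  p = 2 + k
  s = 1 + s′

  open MixedRadix p s

  C : ZMod N → Bool
  C c = A (low c , high c)

  C-enc : ∀ a b j → C (enc a b j) ≡ A (a , b)
  C-enc a b j = cong₂ (λ a′ b′ → A (a′ , b′)) (low-enc a b j) (high-enc a b j)

  -- |C| = s·|A|: every element of A is repeated once for each middle digit.
  size-C : sizeZ N C ≡ sizeZ² p A * s
  size-C = begin
    sizeZ N C                                    ≡⟨ sizeZ-as-sum N C ⟩
    sum (χ ∘ C)                                  ≡⟨ ∑-enc (χ ∘ C) ⟩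
    ∑² p (λ a b → ∑[ j < s ] χ (C (enc a b j)))  ≡⟨ ∑²-cong (λ a b → sum-cong-≗ (cong χ ∘ C-enc a b)) ⟩
    ∑² p (λ a b → ∑[ j < s ] χ (A (a , b)))      ≡⟨ ∑²-cong (λ a b → ∑-const s (χ (A (a , b)))) ⟩
    ∑² p (λ a b → s * χ (A (a , b)))             ≡⟨ sym (∑²-scale s (λ a b → χ (A (a , b)))) ⟩
    s * ∑² p (λ a b → χ (A (a , b)))             ≡⟨ cong (s *_) (sym (sizeZ²-as-sum p A)) ⟩
    s * sizeZ² p A                               ≡⟨ *-comm s (sizeZ² p A) ⟩
    sizeZ² p A * s                               ∎
    where open ≡-Reasoning

  module Representations (x : ZMod N) where

    u v : Fin p
    u = low x
    v = high x

    w : Fin s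
    w = mid x

    toℕ-x : toℕ x ≡ p * (s * toℕ v + toℕ w) + toℕ u
    toℕ-x = trans (cong toℕ (sym (enc-digits x))) (toℕ-enc u v w)

    -- v′ = v + 1 in ℤ/p, with carry η; v′ ≠ v because p ≥ 2.
    v′ : Fin p
    v′ = suc (toℕ v) mod p

    η : ℕ
    η = suc (toℕ v) / p

    suc-v : suc (toℕ v) ≡ toℕ v′ + η * p
    suc-v = trans (m≡m%n+[m/n]*n (suc (toℕ v)) p) (cong (_+ η * p) (sym (toℕ-fromℕ< _)))

    v≢v′ : ¬ v ≡ v′
    v≢v′ v≡v′ = p≢1 (m*n≡1⇒n≡1 η p (sym (+-cancelˡ-≡ (toℕ v) 1 (η * p) v+1≡v+ηp)))
      where
      p≢1 : ¬ p ≡ 1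
      p≢1 ()
      v+1≡v+ηp : toℕ v + 1 ≡ toℕ v + η * p
      v+1≡v+ηp = trans (+-comm (toℕ v) 1) (trans suc-v (cong (λ z → toℕ z + η * p) (sym v≡v′)))

    Hits : Fin p → Fin p → Fin s → Fin p → Fin p → Fin s → Bool
    Hits a₁ b₁ j₁ a₂ b₂ j₂ = eqZ x (subZ (enc a₁ b₁ j₁) (enc a₂ b₂ j₂))

    hits : ∀ {a₁ b₁ j₁ a₂ b₂ j₂} δ t κ →
      toℕ a₁ + δ * p ≡ toℕ a₂ + toℕ u →
      t * s + toℕ j₁ ≡ toℕ j₂ + (toℕ w + δ) →
      toℕ b₁ + κ * p ≡ t + (toℕ b₂ + toℕ v) →
      T (Hits a₁ b₁ j₁ a₂ b₂ j₂)
    hits {a₁} {b₁} {j₁} {a₂} {b₂} {j₂} δ t κ carry-a carry-j carry-b =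
      fromWitness (sym (subZ-unique _ _ x κ (begin
      toℕ (enc a₁ b₁ j₁) + κ * N
        ≡⟨ cong (_+ κ * N) (toℕ-enc a₁ b₁ j₁) ⟩
      p * (s * toℕ b₁ + toℕ j₁) + toℕ a₁ + κ * N
        ≡⟨ digit-difference p s (toℕ a₁) (toℕ a₂) (toℕ u) (toℕ j₁) (toℕ j₂) (toℕ w)
                            (toℕ b₁) (toℕ b₂) (toℕ v) δ t κ carry-a carry-j carry-b ⟩
      p * (s * toℕ b₂ + toℕ j₂) + toℕ a₂ + (p * (s * toℕ v + toℕ w) + toℕ u)
        ≡⟨ sym (cong₂ _+_ (toℕ-enc a₂ b₂ j₂) toℕ-x) ⟩
      toℕ (enc a₂ b₂ j₂) + toℕ x ∎)))
      where open ≡-Reasoning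

    pairCount : Fin p → Fin p → Fin p → Fin p → ℕ
    pairCount a₁ b₁ a₂ b₂ =
      ∑[ j₁ < s ] ∑[ j₂ < s ] χ (A (a₁ , b₁) ∧ A (a₂ , b₂) ∧ Hits a₁ b₁ j₁ a₂ b₂ j₂)

    -- Difference (u , v): choose j₁ = j₂ + w + δ, no wrap-around.
    same-row : ∀ {a₁ b₁ a₂ b₂} → T (A (a₁ , b₁)) → T (A (a₂ , b₂)) →
      u ≡ subZ a₁ a₂ → v ≡ subZ b₁ b₂ → s ∸ 1 ∸ toℕ w ≤ pairCount a₁ b₁ a₂ b₂
    same-row {a₁} {b₁} {a₂} {b₂} inA₁ inA₂ u≡ v≡
      with subZ-carry a₁ a₂ | subZ-carry b₁ b₂
    ... | δ , δ≤1 , carry-a | κ , _ , carry-b = begin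
      s ∸ 1 ∸ toℕ w
        ≡⟨ ∸-+-assoc s 1 (toℕ w) ⟩
      s ∸ (1 + toℕ w)
        ≤⟨ ∸-monoʳ-≤ s (≤-trans (+-monoʳ-≤ (toℕ w) δ≤1) (≤-reflexive (+-comm (toℕ w) 1))) ⟩
      s ∸ (toℕ w + δ)
        ≤⟨ diagonal-count s (toℕ w + δ) (λ j₂ j₁ → R j₁ j₂) onDiagonal ⟩
      ∑[ j₂ < s ] ∑[ j₁ < s ] χ (R j₁ j₂)
        ≡⟨ ∑-comm (λ j₂ j₁ → χ (R j₁ j₂)) ⟩
      pairCount a₁ b₁ a₂ b₂ ∎
      where
      open ≤-Reasoning
      R : Fin s → Fin s → Bool
      R j₁ j₂ = A (a₁ , b₁) ∧ A (a₂ , b₂) ∧ Hits a₁ b₁ j₁ a₂ b₂ j₂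
      onDiagonal : ∀ j₂ j₁ → toℕ j₁ ≡ toℕ j₂ + (toℕ w + δ) → T (R j₁ j₂)
      onDiagonal j₂ j₁ shift = T-∧³ inA₁ inA₂ (hits δ 0 κ
        (trans carry-a (cong (λ z → toℕ a₂ + toℕ z) (sym u≡))) shift
        (trans carry-b (cong (λ z → toℕ b₂ + toℕ z) (sym v≡))))

    -- Difference (u , v + 1): choose j₂ = j₁ + (s - w - δ), wrapping around.
    next-row : ∀ {a₁ b₁ a₂ b₂} → T (A (a₁ , b₁)) → T (A (a₂ , b₂)) →
      u ≡ subZ a₁ a₂ → v′ ≡ subZ b₁ b₂ → toℕ w ≤ pairCount a₁ b₁ a₂ b₂
    next-row {a₁} {b₁} {a₂} {b₂} inA₁ inA₂ u≡ v′≡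
      with subZ-carry a₁ a₂ | subZ-carry b₁ b₂
    ... | δ , δ≤1 , carry-a | ε , _ , carry-b = begin
      toℕ w                  ≤⟨ m≤m+n (toℕ w) δ ⟩
      toℕ w + δ              ≡⟨ sym (m∸[m∸n]≡n w+δ≤s) ⟩
      s ∸ (s ∸ (toℕ w + δ))  ≤⟨ diagonal-count s (s ∸ (toℕ w + δ)) R onDiagonal ⟩
      pairCount a₁ b₁ a₂ b₂  ∎
      where
      open ≤-Reasoning
      R : Fin s → Fin s → Bool
      R j₁ j₂ = A (a₁ , b₁) ∧ A (a₂ , b₂) ∧ Hits a₁ b₁ j₁ a₂ b₂ j₂
      w+δ≤s : toℕ w + δ ≤ s
      w+δ≤s = ≤-trans (+-monoʳ-≤ (toℕ w) δ≤1) (≤-trans (≤-reflexive (+-comm (toℕ w) 1)) (toℕ<n w))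
      wrap : ∀ j₁ j₂ → toℕ j₂ ≡ toℕ j₁ + (s ∸ (toℕ w + δ)) →
        1 * s + toℕ j₁ ≡ toℕ j₂ + (toℕ w + δ)
      wrap j₁ j₂ shift = begin-equality
        1 * s + toℕ j₁                                   ≡⟨ cong (_+ toℕ j₁) (*-identityˡ s) ⟩
        s + toℕ j₁                                       ≡⟨ cong (_+ toℕ j₁) (sym (m∸n+n≡m w+δ≤s)) ⟩
        s ∸ (toℕ w + δ) + (toℕ w + δ) + toℕ j₁           ≡⟨ xy∙z≈zx∙y (s ∸ (toℕ w + δ)) (toℕ w + δ) (toℕ j₁) ⟩
        toℕ j₁ + (s ∸ (toℕ w + δ)) + (toℕ w + δ)         ≡⟨ cong (_+ (toℕ w + δ)) (sym shift) ⟩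
        toℕ j₂ + (toℕ w + δ)                             ∎
      carry : toℕ b₁ + (ε + η) * p ≡ 1 + (toℕ b₂ + toℕ v)
      carry = begin-equality
        toℕ b₁ + (ε + η) * p         ≡⟨ cong (toℕ b₁ +_) (*-distribʳ-+ p ε η) ⟩
        toℕ b₁ + (ε * p + η * p)     ≡⟨ sym (+-assoc (toℕ b₁) (ε * p) (η * p)) ⟩
        toℕ b₁ + ε * p + η * p       ≡⟨ cong (_+ η * p) (trans carry-b (cong (λ z → toℕ b₂ + toℕ z) (sym v′≡))) ⟩
        toℕ b₂ + toℕ v′ + η * p      ≡⟨ +-assoc (toℕ b₂) (toℕ v′) (η * p) ⟩
        toℕ b₂ + (toℕ v′ + η * p)    ≡⟨ cong (toℕ b₂ +_) (sym suc-v) ⟩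
        toℕ b₂ + suc (toℕ v)         ≡⟨ +-suc (toℕ b₂) (toℕ v) ⟩
        1 + (toℕ b₂ + toℕ v)         ∎
      onDiagonal : ∀ j₁ j₂ → toℕ j₂ ≡ toℕ j₁ + (s ∸ (toℕ w + δ)) → T (R j₁ j₂)
      onDiagonal j₁ j₂ shift = T-∧³ inA₁ inA₂ (hits δ 1 (ε + η)
        (trans carry-a (cong (λ z → toℕ a₂ + toℕ z) (sym u≡))) (wrap j₁ j₂ shift) carry)

    -- Each pair of A contributes to at most one of r_A(u , v), r_A(u , v′),
    -- and then with the corresponding weight.
    pair-bound : ∀ a₁ b₁ a₂ b₂ →
      (s ∸ 1 ∸ toℕ w) * differenceIn A (u , v) a₁ b₁ a₂ b₂
        + toℕ w * differenceIn A (u , v′) a₁ b₁ a₂ b₂ ≤ pairCount a₁ b₁ a₂ b₂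
    pair-bound a₁ b₁ a₂ b₂ = exclusive-weights (s ∸ 1 ∸ toℕ w) (toℕ w) disjoint
      (λ h → let (inA₁ , inA₂ , u≡ , v≡) = differs h in same-row inA₁ inA₂ u≡ v≡)
      (λ h → let (inA₁ , inA₂ , u≡ , v′≡) = differs h in next-row inA₁ inA₂ u≡ v′≡)
      where
      Differs : Fin p → Bool
      Differs y = A (a₁ , b₁) ∧ A (a₂ , b₂) ∧ eqZ² (u , y) (subZ² (a₁ , b₁) (a₂ , b₂))
      differs : ∀ {y} → T (Differs y) →
        T (A (a₁ , b₁)) × T (A (a₂ , b₂)) × u ≡ subZ a₁ a₂ × y ≡ subZ b₁ b₂
      differs {y} =
        unpack {α = A (a₁ , b₁)} {β = A (a₂ , b₂)} {u = u} {v = y} {d = subZ a₁ a₂} {e = subZ b₁ b₂}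
      disjoint : T (Differs v) → T (Differs v′) → ⊥
      disjoint h h′ = v≢v′ (trans (proj₂ (proj₂ (proj₂ (differs h))))
                                  (sym (proj₂ (proj₂ (proj₂ (differs h′))))))

    rep-C : rep (elemsZ N) subZ eqZ C x ≡ ∑² p (λ a₁ b₁ → ∑² p (pairCount a₁ b₁))
    rep-C = begin
      rep (elemsZ N) subZ eqZ C x
        ≡⟨ repZ-as-sum N C x ⟩
      ∑[ c₁ < N ] ∑[ c₂ < N ] χ (C c₁ ∧ C c₂ ∧ eqZ x (subZ c₁ c₂))
        ≡⟨ ∑-enc₂ (λ c₁ c₂ → χ (C c₁ ∧ C c₂ ∧ eqZ x (subZ c₁ c₂))) ⟩
      ∑² p (λ a₁ b₁ → ∑² p (λ a₂ b₂ → ∑[ j₁ < s ] ∑[ j₂ < s ]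
        χ (C (enc a₁ b₁ j₁) ∧ C (enc a₂ b₂ j₂) ∧ Hits a₁ b₁ j₁ a₂ b₂ j₂)))
        ≡⟨ ∑²-cong (λ a₁ b₁ → ∑²-cong (λ a₂ b₂ → sum-cong-≗ (λ j₁ → sum-cong-≗ (λ j₂ →
             cong₂ (λ α β → χ (α ∧ β ∧ Hits a₁ b₁ j₁ a₂ b₂ j₂)) (C-enc a₁ b₁ j₁) (C-enc a₂ b₂ j₂))))) ⟩
      ∑² p (λ a₁ b₁ → ∑² p (pairCount a₁ b₁)) ∎
      where open ≡-Reasoning

    rep-C-bound : ∀ g → IsDiffSetZ² p g A → g * (s ∸ 1) ≤ rep (elemsZ N) subZ eqZ C x
    rep-C-bound g A-diff = begin
      g * (s ∸ 1)
        ≡⟨ split ⟩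
      X * g + W * g
        ≤⟨ +-mono-≤ (*-monoʳ-≤ X (A-diff (u , v))) (*-monoʳ-≤ W (A-diff (u , v′))) ⟩
      X * rA (u , v) + W * rA (u , v′)
        ≡⟨ cong₂ (λ r r′ → X * r + W * r′) (repZ²-as-sum p A (u , v)) (repZ²-as-sum p A (u , v′)) ⟩
      X * ∑² p (λ a₁ b₁ → ∑² p (differenceIn A (u , v) a₁ b₁))
        + W * ∑² p (λ a₁ b₁ → ∑² p (differenceIn A (u , v′) a₁ b₁))
        ≡⟨ sym (∑²∑²-linear X W (differenceIn A (u , v)) (differenceIn A (u , v′))) ⟩
      ∑² p (λ a₁ b₁ → ∑² p (λ a₂ b₂ →
        X * differenceIn A (u , v) a₁ b₁ a₂ b₂ + W * differenceIn A (u , v′) a₁ b₁ a₂ b₂))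
        ≤⟨ ∑²-mono (λ a₁ b₁ → ∑²-mono (pair-bound a₁ b₁)) ⟩
      ∑² p (λ a₁ b₁ → ∑² p (pairCount a₁ b₁))
        ≡⟨ sym rep-C ⟩
      rep (elemsZ N) subZ eqZ C x ∎
      where
      open ≤-Reasoning
      X W : ℕ
      X = s ∸ 1 ∸ toℕ w
      W = toℕ w
      rA : ZMod² p → ℕ
      rA = rep (elemsZ² p) subZ² eqZ² A
      split : g * (s ∸ 1) ≡ X * g + W * g
      split = trans (*-comm g (s ∸ 1))
        (trans (cong (_* g) (sym (m∸n+n≡m (s≤s⁻¹ (toℕ<n w))))) (*-distribʳ-+ g X W))

mainTheorem3 : (p : ℕ) → Prime p → (g m : ℕ) → (A : ZMod² p → Bool) →
    IsDiffSetZ² p g A → sizeZ² p A ≡ m →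
    (s : ℕ) → s ≥ 1 →
    Σ (ZMod (p * p * s) → Bool) (λ C →
      IsDiffSetZ (p * p * s) (g * (s ∸ 1)) C × sizeZ (p * p * s) C ≡ m * s)
mainTheorem3 0 p-prime = ⊥-elim (¬prime[0] p-prime)
mainTheorem3 1 p-prime = ⊥-elim (¬prime[1] p-prime)
mainTheorem3 (suc (suc k)) _ g m A A-diff refl (suc s′) _ =
  C , (λ x → Representations.rep-C-bound x g A-diff) , size-C
  where open Construction k s′ A
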